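{- Let $G=(V,E)$ be a finite simple graph with conservative edge-weights $w:E\to\mathbb{Z}$. Define the graph $G'=(V',E')$ by $V'=\{v_1,v_2: v\in V\}\cup\{e_u,e_{uv},e_{vu},e_v: e=\{u,v\}\in E\}$ (all new distinct vertices) and $E'=\{\{v_1,v_2\}: v\in V\}\cup\{\{u_1,e_u\},\{u_2,e_u\},\{e_u,e_{uv}\},\{e_{uv},e_{vu}\},\{e_{vu},e_v\},\{e_v,v_1\},\{e_v,v_2\}: e=\{u,v\}\in E\}$, with weights $w'(\{e_{uv},e_{vu}\})=w(e)$ for each $e=\{u,v\}\in E$ and $w'(e')=0$ for all other $e'\in E'$, and let $M=\{\{v_1,v_2\}:v\in V\}\cup\{\{e_u,e_{uv}\},\{e_{vu},e_v\}: e=\{u,v\}\in E\}$, a perfect matching of $G'$. Then for every integer $k$ and every $p\ge 1$: there exist vertex-disjoint cycles $C_1,\dots,C_p$ in $G$ of total weight $k$ (with respect to $w$) if and only if there exist vertex-disjoint $M$-alternating cycles $C'_1,\dots,C'_p$ in $G'$ of total weight $k$ (with respect to $w'$).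
   Context: Weights are conservative if no cycle of the graph has negative total weight. The weight of an edge set is the sum of its edge weights. An even cycle is $M$-alternating if its edges alternate between edges in $M$ and edges not in $M$. -}

module Defs where

open import Data.Nat using (ℕ; zero; suc; _+_; _%_; NonZero)
open import Data.Nat.DivMod using (m%n<n)
open import Data.Fin using (Fin; toℕ; fromℕ<)
import Data.Fin as F
open import Data.Integer using (ℤ; 0ℤ; _≤_) renaming (_+_ to _+ℤ_)
open import Data.Bool using (Bool; true; false; not)
open import Data.Product using (_×_; _,_; proj₁; proj₂; ∃)
open import Data.Sum using (_⊎_)
open import Relation.Binary.PropositionalEquality using (_≡_; _≢_)
open import Function.Definitions using (Injective)

-- Generic edge-weighted graphs: a vertex type, an edge type, and the
-- two endpoints of every edge (edges are unordered; the pair just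
-- records the endpoints in some order).

record WGraph : Set₁ where
  field
    V    : Set
    E    : Set
    ends : E → V × V
    w    : E → ℤ
open WGraph public

Joins : (G : WGraph) → E G → V G → V G → Set
Joins G e a b = ends G e ≡ (a , b) ⊎ ends G e ≡ (b , a)

csuc : ∀ {k} → Fin (suc k) → Fin (suc k)
csuc {k} i = fromℕ< (m%n<n (suc (toℕ i)) (suc k))

∑ : ∀ {k} → (Fin k → ℤ) → ℤ
∑ {zero}  f = 0ℤ
∑ {suc k} f = f F.zero +ℤ ∑ (λ i → f (F.suc i))

record Cycle (G : WGraph) : Set where
  field
    len     : ℕ
    vs      : Fin (3 + len) → V G
    vs-inj  : Injective _≡_ _≡_ vs
    es      : Fin (3 + len) → E G
    es-join : ∀ i → Joins G (es i) (vs i) (vs (csuc i))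
open Cycle public

cycleWeight : ∀ {G} → Cycle G → ℤ
cycleWeight {G} C = ∑ (λ i → w G (es C i))

Conservative : WGraph → Set
Conservative G = ∀ (C : Cycle G) → 0ℤ ≤ cycleWeight C

data Even : ℕ → Set where
  even0  : Even zero
  even+2 : ∀ {n} → Even n → Even (suc (suc n))

Alternating : (G : WGraph) → (E G → Bool) → Cycle G → Set
Alternating G M C =
  Even (3 + len C) × (∀ i → M (es C (csuc i)) ≡ not (M (es C i)))

VertexDisjoint : ∀ {G p} → (Fin p → Cycle G) → Set
VertexDisjoint {G} {p} C =
  ∀ (i j : Fin p) → i ≢ j → ∀ a b → vs (C i) a ≢ vs (C j) b

totalWeight : ∀ {G p} → (Fin p → Cycle G) → ℤ
totalWeight C = ∑ (λ i → cycleWeight (C i))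

mkG : (n m : ℕ) → (Fin m → Fin n × Fin n) → (Fin m → ℤ) → WGraph
mkG n m ends w = record { V = Fin n ; E = Fin m ; ends = ends ; w = w }

Simple : ∀ {n m} → (Fin m → Fin n × Fin n) → Set
Simple {n} {m} ends =
  (∀ e → proj₁ (ends e) ≢ proj₂ (ends e)) ×
  (∀ e f → (ends e ≡ ends f ⊎ ends e ≡ (proj₂ (ends f) , proj₁ (ends f))) → e ≡ f)

data V' (n m : ℕ) : Set where
  v₁ v₂ : Fin n → V' n m
  e-u e-uv e-vu e-v : Fin m → V' n m

data E' (n m : ℕ) : Set where
  vv    : Fin n → E' n m
  u₁eu  : Fin m → E' n m
  u₂eu  : Fin m → E' n m
  eueuv : Fin m → E' n m
  euvevu : Fin m → E' n m
  evuev : Fin m → E' n m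
  evv₁  : Fin m → E' n m
  evv₂  : Fin m → E' n m

module _ {n m : ℕ} (ends : Fin m → Fin n × Fin n) (w : Fin m → ℤ) where

  ends' : E' n m → V' n m × V' n m
  ends' (vv v)     = v₁ v , v₂ v
  ends' (u₁eu e)   = v₁ (proj₁ (ends e)) , e-u e
  ends' (u₂eu e)   = v₂ (proj₁ (ends e)) , e-u e
  ends' (eueuv e)  = e-u e , e-uv e
  ends' (euvevu e) = e-uv e , e-vu e
  ends' (evuev e)  = e-vu e , e-v e
  ends' (evv₁ e)   = e-v e , v₁ (proj₂ (ends e))
  ends' (evv₂ e)   = e-v e , v₂ (proj₂ (ends e))

  w' : E' n m → ℤ
  w' (euvevu e) = w e
  w' _          = 0ℤ

  G' : WGraph
  G' = record { V = V' n m ; E = E' n m ; ends = ends' ; w = w' }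

  M : E' n m → Bool
  M (vv _)    = true
  M (eueuv _) = true
  M (evuev _) = true
  M _         = false

-- A cycle of G lifts step by step: the step x –f→ y becomes the six edges v₁x v₂x, then through the gadget
-- of f from the x side (e_x, e_xy, e_yx, e_y) to v₁y.  These alternate between M and non-M edges, and only
-- the middle edge e_xy e_yx has nonzero weight, namely w f.  Conversely every vertex of G′ lies on exactly
-- one M-edge, so an M-alternating cycle that uses a copy edge {x₁,x₂} is forced through a whole gadget,
-- reaching the copy edge of the other end y of some edge f after six steps.  Hence the cycle splits into
-- such passes and contracts to a closed walk in G of the same weight; it is a cycle since a repeated vertex
-- would repeat a copy edge, while one or two passes would need a loop or two parallel edges in G.
-- Vertex-disjointness transfers because each construction maps every vertex into the other cycle.

module Submission where

open import Defs
open import Data.Nat using (ℕ; zero; suc; _+_; _*_; _<_; _≤_; _%_; _/_; z≤n; s≤s; NonZero)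
import Data.Nat.Properties as ℕ
open import Data.Nat.DivMod using (_mod_; m%n<n; m≡m%n+[m/n]*n; [m+n]%n≡m%n; m<n⇒m%n≡m; m%n%n≡m%n; %-distribˡ-+; m<n*o⇒m/o<n)
open import Data.Fin using (Fin; toℕ)
import Data.Fin as Fin
import Data.Fin.Properties as Fin
open import Data.Integer using (ℤ; 0ℤ) renaming (_+_ to _+ℤ_)
import Data.Integer.Properties as ℤ
open import Data.Bool using (Bool; true; false; not)
open import Data.Product using (_×_; _,_; Σ; ∃-syntax; proj₁; proj₂)
open import Data.Sum using (_⊎_; inj₁; inj₂; [_,_]′)
open import Data.Sum.Properties using (inj₁-injective; inj₂-injective)
open import Data.Empty using (⊥; ⊥-elim)
open import Function using (id; _∘_)
open import Function.Bundles using (_⇔_; mk⇔)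
open import Relation.Nullary using (yes; no; does)
open import Relation.Binary.PropositionalEquality
open import Algebra.Properties.CommutativeSemigroup ℕ.+-commutativeSemigroup using (x∙yz≈y∙xz)

sumℕ : (ℕ → ℤ) → ℕ → ℤ
sumℕ f zero    = 0ℤ
sumℕ f (suc n) = f 0 +ℤ sumℕ (λ t → f (suc t)) n

sumℕ-cong : ∀ {f g : ℕ → ℤ} n → (∀ t → t < n → f t ≡ g t) → sumℕ f n ≡ sumℕ g n
sumℕ-cong zero    f≗g = refl
sumℕ-cong (suc n) f≗g = cong₂ _+ℤ_ (f≗g 0 (s≤s z≤n)) (sumℕ-cong n (λ t t<n → f≗g (suc t) (s≤s t<n)))

sumℕ-+ : ∀ f a b → sumℕ f (a + b) ≡ sumℕ f a +ℤ sumℕ (λ t → f (a + t)) b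
sumℕ-+ f zero    b = sym (ℤ.+-identityˡ _)
sumℕ-+ f (suc a) b = begin
  f 0 +ℤ sumℕ (λ t → f (suc t)) (a + b)                              ≡⟨ cong (f 0 +ℤ_) (sumℕ-+ (λ t → f (suc t)) a b) ⟩
  f 0 +ℤ (sumℕ (λ t → f (suc t)) a +ℤ sumℕ (λ t → f (suc a + t)) b)  ≡⟨ sym (ℤ.+-assoc (f 0) _ _) ⟩
  sumℕ f (suc a) +ℤ sumℕ (λ t → f (suc a + t)) b                       ∎
  where open ≡-Reasoning

sumℕ-chunks : ∀ f b k → sumℕ f (k * b) ≡ sumℕ (λ q → sumℕ (λ r → f (r + q * b)) b) k
sumℕ-chunks f b zero    = refl
sumℕ-chunks f b (suc k) = begin
  sumℕ f (b + k * b)                                                   ≡⟨ sumℕ-+ f b (k * b) ⟩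
  sumℕ f b +ℤ sumℕ (λ t → f (b + t)) (k * b)                           ≡⟨ cong₂ _+ℤ_ (sumℕ-cong b (λ r _ → cong f (sym (ℕ.+-identityʳ r))))
                                                                              (sumℕ-chunks (λ t → f (b + t)) b k) ⟩
  sumℕ (λ r → f (r + 0)) b +ℤ sumℕ (λ q → sumℕ (λ r → f (b + (r + q * b))) b) k
                                                                       ≡⟨ cong (sumℕ (λ r → f (r + 0)) b +ℤ_)
                                                                              (sumℕ-cong k (λ q _ → sumℕ-cong b (λ r _ → cong f (x∙yz≈y∙xz b r (q * b))))) ⟩
  sumℕ (λ q → sumℕ (λ r → f (r + q * b)) b) (suc k)                    ∎
  where open ≡-Reasoning

sumℕ-snoc : ∀ f n → sumℕ f (suc n) ≡ sumℕ f n +ℤ f n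
sumℕ-snoc f zero    = trans (ℤ.+-identityʳ (f 0)) (sym (ℤ.+-identityˡ (f 0)))
sumℕ-snoc f (suc n) = trans (cong (f 0 +ℤ_) (sumℕ-snoc (λ t → f (suc t)) n)) (sym (ℤ.+-assoc (f 0) _ _))

sumℕ-rotate : ∀ f n → f n ≡ f 0 → sumℕ (λ t → f (suc t)) n ≡ sumℕ f n
sumℕ-rotate f zero    _       = refl
sumℕ-rotate f (suc n) fn≡f0 = begin
  sumℕ (λ t → f (suc t)) (suc n)          ≡⟨ sumℕ-snoc (λ t → f (suc t)) n ⟩
  sumℕ (λ t → f (suc t)) n +ℤ f (suc n)   ≡⟨ cong (sumℕ (λ t → f (suc t)) n +ℤ_) fn≡f0 ⟩
  sumℕ (λ t → f (suc t)) n +ℤ f 0         ≡⟨ ℤ.+-comm _ (f 0) ⟩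
  sumℕ f (suc n)                           ∎
  where open ≡-Reasoning

∑-cong : ∀ {k} {f g : Fin k → ℤ} → (∀ i → f i ≡ g i) → ∑ f ≡ ∑ g
∑-cong {zero}  f≗g = refl
∑-cong {suc k} f≗g = cong₂ _+ℤ_ (f≗g Fin.zero) (∑-cong (λ i → f≗g (Fin.suc i)))

∑≡sumℕ : ∀ k (f : ℕ → ℤ) → ∑ {k} (λ i → f (toℕ i)) ≡ sumℕ f k
∑≡sumℕ zero    f = refl
∑≡sumℕ (suc k) f = cong (f 0 +ℤ_) (∑≡sumℕ k (λ t → f (suc t)))

-- blocks B lists B 0 0, …, B 0 5, B 1 0, …, B 1 5, …
blocks : {A : Set} → (ℕ → ℕ → A) → ℕ → A
blocks B (suc (suc (suc (suc (suc (suc t)))))) = blocks (λ q → B (suc q)) t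
blocks B r                                       = B 0 r

module _ {A : Set} where

  blocks-shift : ∀ (B : ℕ → ℕ → A) k t → blocks B (k * 6 + t) ≡ blocks (λ q → B (k + q)) t
  blocks-shift B zero    t = refl
  blocks-shift B (suc k) t = blocks-shift (λ q → B (suc q)) k t

  blocks-head : ∀ (B : ℕ → ℕ → A) r → r < 6 → blocks B r ≡ B 0 r
  blocks-head B 0 _ = refl
  blocks-head B 1 _ = refl
  blocks-head B 2 _ = refl
  blocks-head B 3 _ = refl
  blocks-head B 4 _ = refl
  blocks-head B 5 _ = refl
  blocks-head B (suc (suc (suc (suc (suc (suc r)))))) (s≤s (s≤s (s≤s (s≤s (s≤s (s≤s ()))))))

  blocks-at : ∀ (B : ℕ → ℕ → A) q r → r < 6 → blocks B (r + q * 6) ≡ B q r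
  blocks-at B q r r<6 = begin
    blocks B (r + q * 6)                 ≡⟨ cong (blocks B) (ℕ.+-comm r (q * 6)) ⟩
    blocks B (q * 6 + r)                 ≡⟨ blocks-shift B q r ⟩
    blocks (λ q′ → B (q + q′)) r          ≡⟨ blocks-head _ r r<6 ⟩
    B (q + 0) r                          ≡⟨ cong (λ q′ → B q′ r) (ℕ.+-identityʳ q) ⟩
    B q r                                ∎
    where open ≡-Reasoning

  blocks-decompose : ∀ (B : ℕ → ℕ → A) t → blocks B t ≡ B (t / 6) (t % 6)
  blocks-decompose B t = trans (cong (blocks B) (m≡m%n+[m/n]*n t 6)) (blocks-at B (t / 6) (t % 6) (m%n<n t 6))

  blocks-cong : ∀ {B B′ : ℕ → ℕ → A} → (∀ q r → B q r ≡ B′ q r) → ∀ t → blocks B t ≡ blocks B′ t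
  blocks-cong {B} {B′} B≗B′ t = trans (blocks-decompose B t) (trans (B≗B′ _ _) (sym (blocks-decompose B′ t)))

  blocks-sum : ∀ (f : A → ℤ) (B : ℕ → ℕ → A) k →
    sumℕ (λ t → f (blocks B t)) (k * 6) ≡ sumℕ (λ q → sumℕ (λ r → f (B q r)) 6) k
  blocks-sum f B k = trans (sumℕ-chunks _ 6 k)
    (sumℕ-cong k (λ q _ → sumℕ-cong 6 (λ r r<6 → cong f (blocks-at B q r r<6))))

Even-*6 : ∀ k → Even (k * 6)
Even-*6 zero    = even0
Even-*6 (suc k) = even+2 (even+2 (even+2 (Even-*6 k)))

periodic-mod : ∀ {A : Set} (f : ℕ → A) L .{{_ : NonZero L}} → (∀ t → f (L + t) ≡ f t) → ∀ t → f (t % L) ≡ f t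
periodic-mod f L f-periodic t = begin
  f (t % L)                ≡⟨ sym (repeat (t / L)) ⟩
  f (t % L + (t / L) * L)  ≡⟨ cong f (sym (m≡m%n+[m/n]*n t L)) ⟩
  f t                      ∎
  where
  open ≡-Reasoning
  repeat : ∀ q → f (t % L + q * L) ≡ f (t % L)
  repeat zero    = cong f (ℕ.+-identityʳ _)
  repeat (suc q) = trans (cong f (x∙yz≈y∙xz (t % L) L (q * L))) (trans (f-periodic _) (repeat q))

suc-% : ∀ t L .{{_ : NonZero L}} → suc (t % L) % L ≡ suc t % L
suc-% t L = begin
  (1 + t % L) % L              ≡⟨ %-distribˡ-+ 1 (t % L) L ⟩
  (1 % L + t % L % L) % L      ≡⟨ cong (λ x → (1 % L + x) % L) (m%n%n≡m%n t L) ⟩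
  (1 % L + t % L) % L          ≡⟨ sym (%-distribˡ-+ 1 t L) ⟩
  (1 + t) % L                  ∎
  where open ≡-Reasoning

module _ {k : ℕ} where
  private
    L : ℕ
    L = suc k

  toℕ-mod : ∀ t → toℕ (t mod L) ≡ t % L
  toℕ-mod t = Fin.toℕ-fromℕ< (m%n<n t L)

  csuc-mod : ∀ t → csuc (t mod L) ≡ suc t mod L
  csuc-mod t = Fin.toℕ-injective (begin
    toℕ (csuc (t mod L))       ≡⟨ toℕ-mod (suc (toℕ (t mod L))) ⟩
    suc (toℕ (t mod L)) % L    ≡⟨ cong (λ x → suc x % L) (toℕ-mod t) ⟩
    suc (t % L) % L            ≡⟨ suc-% t L ⟩
    suc t % L                  ≡⟨ sym (toℕ-mod (suc t)) ⟩
    toℕ (suc t mod L)          ∎)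
    where open ≡-Reasoning

  mod-periodic : ∀ t → (L + t) mod L ≡ t mod L
  mod-periodic t = Fin.toℕ-injective (begin
    toℕ ((L + t) mod L)  ≡⟨ toℕ-mod (L + t) ⟩
    (L + t) % L          ≡⟨ cong (_% L) (ℕ.+-comm L t) ⟩
    (t + L) % L          ≡⟨ [m+n]%n≡m%n t L ⟩
    t % L                ≡⟨ sym (toℕ-mod t) ⟩
    toℕ (t mod L)        ∎)
    where open ≡-Reasoning

  toℕ-mod-inverse : ∀ (i : Fin L) → toℕ i mod L ≡ i
  toℕ-mod-inverse i = Fin.toℕ-injective (trans (toℕ-mod (toℕ i)) (m<n⇒m%n≡m (Fin.toℕ<n i)))

  mod-injective : ∀ a b → a < L → b < L → a mod L ≡ b mod L → a ≡ b
  mod-injective a b a<L b<L eq = begin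
    a                ≡⟨ sym (m<n⇒m%n≡m a<L) ⟩
    a % L            ≡⟨ sym (toℕ-mod a) ⟩
    toℕ (a mod L)    ≡⟨ cong toℕ eq ⟩
    toℕ (b mod L)    ≡⟨ toℕ-mod b ⟩
    b % L            ≡⟨ m<n⇒m%n≡m b<L ⟩
    b                ∎
    where open ≡-Reasoning

record Unrolled (G : WGraph) : Set where
  field
    size             : ℕ
    vertex           : ℕ → V G
    edge             : ℕ → E G
    vertex-periodic  : ∀ t → vertex (3 + size + t) ≡ vertex t
    edge-periodic    : ∀ t → edge (3 + size + t) ≡ edge t
    edge-joins       : ∀ t → Joins G (edge t) (vertex t) (vertex (suc t))
    vertex-injective : ∀ a b → a < 3 + size → b < 3 + size → vertex a ≡ vertex b → a ≡ b
open Unrolled public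

module _ {G : WGraph} where

  period : Unrolled G → ℕ
  period c = 3 + size c

  weight : Unrolled G → ℤ
  weight c = sumℕ (λ t → w G (edge c t)) (period c)

  Alternates : (E G → Bool) → Unrolled G → Set
  Alternates M c = ∀ t → M (edge c (suc t)) ≡ not (M (edge c t))

  vertex-period : (c : Unrolled G) → vertex c (period c) ≡ vertex c 0
  vertex-period c = trans (cong (vertex c) (sym (ℕ.+-identityʳ _))) (vertex-periodic c 0)

  edge-period : (c : Unrolled G) → edge c (period c) ≡ edge c 0
  edge-period c = trans (cong (edge c) (sym (ℕ.+-identityʳ _))) (edge-periodic c 0)

  module _ (C : Cycle G) where
    private
      L : ℕ
      L = 3 + len C

    unroll : Unrolled G
    unroll = record
      { size             = len C
      ; vertex           = λ t → vs C (t mod L)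
      ; edge             = λ t → es C (t mod L)
      ; vertex-periodic  = λ t → cong (vs C) (mod-periodic t)
      ; edge-periodic    = λ t → cong (es C) (mod-periodic t)
      ; edge-joins       = λ t → subst (Joins G (es C (t mod L)) (vs C (t mod L)) ∘ vs C)
                                       (csuc-mod t) (es-join C (t mod L))
      ; vertex-injective = λ a b a<L b<L eq → mod-injective a b a<L b<L (vs-inj C eq)
      }

    unroll-weight : weight unroll ≡ cycleWeight C
    unroll-weight = sym (begin
      ∑ (λ i → w G (es C i))                  ≡⟨ ∑-cong (λ i → cong (w G ∘ es C) (sym (toℕ-mod-inverse i))) ⟩
      ∑ {L} (λ i → w G (es C (toℕ i mod L)))  ≡⟨ ∑≡sumℕ L (λ t → w G (es C (t mod L))) ⟩
      weight unroll                           ∎)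
      where open ≡-Reasoning

    unroll-alternates : ∀ M → (∀ i → M (es C (csuc i)) ≡ not (M (es C i))) → Alternates M unroll
    unroll-alternates M alt t = subst (λ i → M (es C i) ≡ not (M (es C (t mod L)))) (csuc-mod t) (alt (t mod L))

  module _ (c : Unrolled G) where
    private
      L : ℕ
      L = period c

    vertex-mod : ∀ t → vertex c (t % L) ≡ vertex c t
    vertex-mod = periodic-mod (vertex c) L (vertex-periodic c)

    edge-mod : ∀ t → edge c (t % L) ≡ edge c t
    edge-mod = periodic-mod (edge c) L (edge-periodic c)

    roll : Cycle G
    roll = record
      { len     = size c
      ; vs      = vertex c ∘ toℕ
      ; vs-inj  = λ {i} {j} eq → Fin.toℕ-injective (vertex-injective c (toℕ i) (toℕ j) (Fin.toℕ<n i) (Fin.toℕ<n j) eq)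
      ; es      = edge c ∘ toℕ
      ; es-join = λ i → subst (Joins G (edge c (toℕ i)) (vertex c (toℕ i)))
                              (sym (trans (cong (vertex c) (toℕ-mod (suc (toℕ i)))) (vertex-mod (suc (toℕ i)))))
                              (edge-joins c (toℕ i))
      }

    roll-weight : cycleWeight roll ≡ weight c
    roll-weight = ∑≡sumℕ L (λ t → w G (edge c t))

    roll-alternates : ∀ M → Alternates M c → ∀ i → M (es roll (csuc i)) ≡ not (M (es roll i))
    roll-alternates M alt i = subst (λ e → M e ≡ not (M (edge c (toℕ i))))
                                    (sym (trans (cong (edge c) (toℕ-mod (suc (toℕ i)))) (edge-mod (suc (toℕ i)))))
                                    (alt (toℕ i))

  rotate : Unrolled G → Unrolled G
  rotate c = record
    { size             = size c
    ; vertex           = vertex c ∘ suc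
    ; edge             = edge c ∘ suc
    ; vertex-periodic  = λ t → trans (cong (vertex c) (sym (ℕ.+-suc (period c) t))) (vertex-periodic c (suc t))
    ; edge-periodic    = λ t → trans (cong (edge c) (sym (ℕ.+-suc (period c) t))) (edge-periodic c (suc t))
    ; edge-joins       = edge-joins c ∘ suc
    ; vertex-injective = shifted-injective
    }
    where
    L = period c
    shifted-injective : ∀ a b → a < L → b < L → vertex c (suc a) ≡ vertex c (suc b) → a ≡ b
    shifted-injective a b a<L b<L eq with ℕ.m≤n⇒m<n∨m≡n a<L | ℕ.m≤n⇒m<n∨m≡n b<L
    ... | inj₁ 1+a<L | inj₁ 1+b<L = ℕ.suc-injective (vertex-injective c _ _ 1+a<L 1+b<L eq)
    ... | inj₂ 1+a≡L | inj₂ 1+b≡L = ℕ.suc-injective (trans 1+a≡L (sym 1+b≡L))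
    ... | inj₁ 1+a<L | inj₂ 1+b≡L
        with () ← vertex-injective c _ 0 1+a<L (s≤s z≤n) (trans eq (trans (cong (vertex c) 1+b≡L) (vertex-period c)))
    ... | inj₂ 1+a≡L | inj₁ 1+b<L
        with () ← vertex-injective c 0 _ (s≤s z≤n) 1+b<L (trans (sym (vertex-period c)) (trans (cong (vertex c) (sym 1+a≡L)) eq))

  rotate-weight : ∀ c → weight (rotate c) ≡ weight c
  rotate-weight c = sumℕ-rotate (λ t → w G (edge c t)) (period c) (cong (w G) (edge-period c))

  rotateBy : ℕ → Unrolled G → Unrolled G
  rotateBy zero    c = c
  rotateBy (suc k) c = rotateBy k (rotate c)

  rotateBy-vertex : ∀ k c t → vertex (rotateBy k c) t ≡ vertex c (k + t)
  rotateBy-vertex zero    c t = refl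
  rotateBy-vertex (suc k) c t = rotateBy-vertex k (rotate c) t

  rotateBy-edge : ∀ k c t → edge (rotateBy k c) t ≡ edge c (k + t)
  rotateBy-edge zero    c t = refl
  rotateBy-edge (suc k) c t = rotateBy-edge k (rotate c) t

  rotateBy-weight : ∀ k c → weight (rotateBy k c) ≡ weight c
  rotateBy-weight zero    c = refl
  rotateBy-weight (suc k) c = trans (rotateBy-weight k (rotate c)) (rotate-weight c)

  rotateBy-alternates : ∀ M k c → Alternates M c → Alternates M (rotateBy k c)
  rotateBy-alternates M zero    c alt = alt
  rotateBy-alternates M (suc k) c alt = rotateBy-alternates M k (rotate c) (alt ∘ suc)

Joins-sym : ∀ {G e a b} → Joins G e a b → Joins G e b a
Joins-sym (inj₁ p) = inj₂ p
Joins-sym (inj₂ p) = inj₁ p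

Joins-unique : ∀ {G e a a′ b b′} → Joins G e a a′ → Joins G e b b′ → (a ≡ b × a′ ≡ b′) ⊎ (a ≡ b′ × a′ ≡ b)
Joins-unique (inj₁ p) (inj₁ q) = inj₁ (cong proj₁ (trans (sym p) q) , cong proj₂ (trans (sym p) q))
Joins-unique (inj₁ p) (inj₂ q) = inj₂ (cong proj₁ (trans (sym p) q) , cong proj₂ (trans (sym p) q))
Joins-unique (inj₂ p) (inj₁ q) = inj₂ (cong proj₂ (trans (sym p) q) , cong proj₁ (trans (sym p) q))
Joins-unique (inj₂ p) (inj₂ q) = inj₁ (cong proj₂ (trans (sym p) q) , cong proj₁ (trans (sym p) q))

module _ {G : WGraph} (c : Unrolled G) where
  private
    L = period c

  -- Needs L ≥ 3: on a cycle of length 2 the second step reverses the first.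
  no-reversed-step : ∀ a b → a < L → b < L → vertex c a ≡ vertex c (suc b) → vertex c (suc a) ≡ vertex c b → ⊥
  no-reversed-step a b a<L b<L Va≡V1+b V1+a≡Vb with ℕ.m≤n⇒m<n∨m≡n b<L
  ... | inj₂ 1+b≡L
      with refl ← vertex-injective c a 0 a<L (s≤s z≤n) (trans Va≡V1+b (trans (cong (vertex c) 1+b≡L) (vertex-period c)))
      with refl ← vertex-injective c 1 b (s≤s (s≤s z≤n)) b<L V1+a≡Vb
      with () ← 1+b≡L
  ... | inj₁ 1+b<L
      with refl ← vertex-injective c a (suc b) a<L 1+b<L Va≡V1+b
      with ℕ.m≤n⇒m<n∨m≡n 1+b<L
  ...   | inj₁ 2+b<L with () ← vertex-injective c (suc (suc b)) b 2+b<L b<L V1+a≡Vb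
  ...   | inj₂ 2+b≡L
      with refl ← vertex-injective c 0 b (s≤s z≤n) b<L (trans (sym (vertex-period c)) (trans (cong (vertex c) (sym 2+b≡L)) V1+a≡Vb))
      with () ← 2+b≡L

  edge-injective : ∀ a b → a < L → b < L → edge c a ≡ edge c b → a ≡ b
  edge-injective a b a<L b<L eq
    with Joins-unique {G} (edge-joins c a) (subst (λ e → Joins G e (vertex c b) (vertex c (suc b))) (sym eq) (edge-joins c b))
  ... | inj₁ (Va≡Vb , _)           = vertex-injective c a b a<L b<L Va≡Vb
  ... | inj₂ (Va≡V1+b , V1+a≡Vb)   = ⊥-elim (no-reversed-step a b a<L b<L Va≡V1+b V1+a≡Vb)

VertexDisjoint-comap : ∀ {G K p} (C : Fin p → Cycle G) (D : Fin p → Cycle K) (h : V K → V G) →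
  (∀ i a → Σ (Fin (3 + len (C i))) λ b → h (vs (D i) a) ≡ vs (C i) b) → VertexDisjoint C → VertexDisjoint D
VertexDisjoint-comap C D h covers disjoint i j i≢j a b eq =
  disjoint i j i≢j (proj₁ (covers i a)) (proj₁ (covers j b))
    (trans (sym (proj₂ (covers i a))) (trans (cong h eq) (proj₂ (covers j b))))

module Gadget {n m : ℕ} (ends : Fin m → Fin n × Fin n) (w : Fin m → ℤ) where

  G : WGraph
  G = mkG n m ends w

  H : WGraph
  H = G' ends w

  -- Booleans index the two copies v₁/v₂ of a vertex and the two ends u/v of an edge.
  endpoint : Bool → Fin m → Fin n
  endpoint true  f = proj₁ (ends f)
  endpoint false f = proj₂ (ends f)

  copy : Bool → Fin n → V' n m
  copy true  = v₁
  copy false = v₂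

  port : Bool → Fin m → V' n m
  port true  = e-u
  port false = e-v

  inner : Bool → Fin m → V' n m
  inner true  = e-uv
  inner false = e-vu

  link : Bool → Bool → Fin m → E' n m
  link true  true  = u₁eu
  link false true  = u₂eu
  link true  false = evv₁
  link false false = evv₂

  stem : Bool → Fin m → E' n m
  stem true  = eueuv
  stem false = evuev

  endpoint-joins : ∀ o f → Joins G f (endpoint o f) (endpoint (not o) f)
  endpoint-joins true  f = inj₁ refl
  endpoint-joins false f = inj₂ refl

  link-joins : ∀ c o f → Joins H (link c o f) (copy c (endpoint o f)) (port o f)
  link-joins true  true  f = inj₁ refl
  link-joins false true  f = inj₁ refl
  link-joins true  false f = inj₂ refl
  link-joins false false f = inj₂ refl

  stem-joins : ∀ o f → Joins H (stem o f) (port o f) (inner o f)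
  stem-joins true  f = inj₁ refl
  stem-joins false f = inj₂ refl

  bridge-joins : ∀ o f → Joins H (euvevu f) (inner o f) (inner (not o) f)
  bridge-joins true  f = inj₁ refl
  bridge-joins false f = inj₂ refl

  M-link : ∀ c o f → M ends w (link c o f) ≡ false
  M-link true  true  f = refl
  M-link false true  f = refl
  M-link true  false f = refl
  M-link false false f = refl

  M-stem : ∀ o f → M ends w (stem o f) ≡ true
  M-stem true  f = refl
  M-stem false f = refl

  w′-link : ∀ c o f → w' ends w (link c o f) ≡ 0ℤ
  w′-link true  true  f = refl
  w′-link false true  f = refl
  w′-link true  false f = refl
  w′-link false false f = refl

  w′-stem : ∀ o f → w' ends w (stem o f) ≡ 0ℤ
  w′-stem true  f = refl
  w′-stem false f = refl

  -- The pass from vertex x through the gadget of f, entered at its end o: positions 0,1 are the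
  -- copies of x, positions 2–5 the gadget vertices of f.
  passVertex : Fin n → Bool → Fin m → ℕ → V' n m
  passVertex x o f 0 = v₁ x
  passVertex x o f 1 = v₂ x
  passVertex x o f 2 = port o f
  passVertex x o f 3 = inner o f
  passVertex x o f 4 = inner (not o) f
  passVertex x o f _ = port (not o) f

  passEdge : Fin n → (c o c′ : Bool) → Fin m → ℕ → E' n m
  passEdge x c o c′ f 0 = vv x
  passEdge x c o c′ f 1 = link c o f
  passEdge x c o c′ f 2 = stem o f
  passEdge x c o c′ f 3 = euvevu f
  passEdge x c o c′ f 4 = stem (not o) f
  passEdge x c o c′ f _ = link c′ (not o) f

  passEdge-weight : ∀ x c o c′ f → sumℕ (λ r → w' ends w (passEdge x c o c′ f r)) 6 ≡ w f
  passEdge-weight x c o c′ f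
    rewrite w′-link c o f | w′-stem o f | w′-stem (not o) f | w′-link c′ (not o) f
    = trans (ℤ.+-identityˡ _) (trans (ℤ.+-identityˡ _) (trans (ℤ.+-identityˡ _) (ℤ.+-identityʳ (w f))))

  passEdge-alternates : ∀ x c o c′ f r → r < 5 →
    M ends w (passEdge x c o c′ f (suc r)) ≡ not (M ends w (passEdge x c o c′ f r))
  passEdge-alternates x c o c′ f 0 _ = M-link c o f
  passEdge-alternates x c o c′ f 1 _ = trans (M-stem o f) (cong not (sym (M-link c o f)))
  passEdge-alternates x c o c′ f 2 _ = cong not (sym (M-stem o f))
  passEdge-alternates x c o c′ f 3 _ = M-stem (not o) f
  passEdge-alternates x c o c′ f 4 _ = trans (M-link c′ (not o) f) (cong not (sym (M-stem (not o) f)))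
  passEdge-alternates x c o c′ f (suc (suc (suc (suc (suc r))))) (s≤s (s≤s (s≤s (s≤s (s≤s ())))))

  passEdge-exit : ∀ x c o c′ f y → M ends w (vv y) ≡ not (M ends w (passEdge x c o c′ f 5))
  passEdge-exit x c o c′ f y = cong not (sym (M-link c′ (not o) f))

  link≢vv : ∀ c o f y → link c o f ≢ vv y
  link≢vv true  true  f y ()
  link≢vv false true  f y ()
  link≢vv true  false f y ()
  link≢vv false false f y ()

  stem≢vv : ∀ o f y → stem o f ≢ vv y
  stem≢vv true  f y ()
  stem≢vv false f y ()

  passEdge-not-vv : ∀ x c o c′ f r y → passEdge x c o c′ f (suc r) ≢ vv y
  passEdge-not-vv x c o c′ f 0 = link≢vv c o f
  passEdge-not-vv x c o c′ f 1 = stem≢vv o f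
  passEdge-not-vv x c o c′ f 2 y ()
  passEdge-not-vv x c o c′ f 3 = stem≢vv (not o) f
  passEdge-not-vv x c o c′ f (suc (suc (suc (suc r)))) = link≢vv c′ (not o) f

  -- Oriented edges of M, indexed by their concrete endpoints so that matching on them determines these.
  data Matched : E' n m → V' n m → V' n m → Set where
    vv→    : ∀ x → Matched (vv x) (v₁ x) (v₂ x)
    vv←    : ∀ x → Matched (vv x) (v₂ x) (v₁ x)
    eueuv→ : ∀ f → Matched (eueuv f) (e-u f) (e-uv f)
    eueuv← : ∀ f → Matched (eueuv f) (e-uv f) (e-u f)
    evuev→ : ∀ f → Matched (evuev f) (e-vu f) (e-v f)
    evuev← : ∀ f → Matched (evuev f) (e-v f) (e-vu f)

  data Unmatched : E' n m → V' n m → V' n m → Set where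
    u₁eu→  : ∀ f → Unmatched (u₁eu f) (v₁ (proj₁ (ends f))) (e-u f)
    u₁eu←  : ∀ f → Unmatched (u₁eu f) (e-u f) (v₁ (proj₁ (ends f)))
    u₂eu→  : ∀ f → Unmatched (u₂eu f) (v₂ (proj₁ (ends f))) (e-u f)
    u₂eu←  : ∀ f → Unmatched (u₂eu f) (e-u f) (v₂ (proj₁ (ends f)))
    euvevu→ : ∀ f → Unmatched (euvevu f) (e-uv f) (e-vu f)
    euvevu← : ∀ f → Unmatched (euvevu f) (e-vu f) (e-uv f)
    evv₁→  : ∀ f → Unmatched (evv₁ f) (e-v f) (v₁ (proj₂ (ends f)))
    evv₁←  : ∀ f → Unmatched (evv₁ f) (v₁ (proj₂ (ends f))) (e-v f)
    evv₂→  : ∀ f → Unmatched (evv₂ f) (e-v f) (v₂ (proj₂ (ends f)))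
    evv₂←  : ∀ f → Unmatched (evv₂ f) (v₂ (proj₂ (ends f))) (e-v f)

  matched : ∀ {e a b} → M ends w e ≡ true → Joins H e a b → Matched e a b
  matched {vv x}    _ (inj₁ refl) = vv→ x
  matched {vv x}    _ (inj₂ refl) = vv← x
  matched {eueuv f} _ (inj₁ refl) = eueuv→ f
  matched {eueuv f} _ (inj₂ refl) = eueuv← f
  matched {evuev f} _ (inj₁ refl) = evuev→ f
  matched {evuev f} _ (inj₂ refl) = evuev← f
  matched {u₁eu f}   () _
  matched {u₂eu f}   () _
  matched {euvevu f} () _
  matched {evv₁ f}   () _
  matched {evv₂ f}   () _

  unmatched : ∀ {e a b} → M ends w e ≡ false → Joins H e a b → Unmatched e a b
  unmatched {u₁eu f}   _ (inj₁ refl) = u₁eu→ f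
  unmatched {u₁eu f}   _ (inj₂ refl) = u₁eu← f
  unmatched {u₂eu f}   _ (inj₁ refl) = u₂eu→ f
  unmatched {u₂eu f}   _ (inj₂ refl) = u₂eu← f
  unmatched {euvevu f} _ (inj₁ refl) = euvevu→ f
  unmatched {euvevu f} _ (inj₂ refl) = euvevu← f
  unmatched {evv₁ f}   _ (inj₁ refl) = evv₁→ f
  unmatched {evv₁ f}   _ (inj₂ refl) = evv₁← f
  unmatched {evv₂ f}   _ (inj₁ refl) = evv₂→ f
  unmatched {evv₂ f}   _ (inj₂ refl) = evv₂← f
  unmatched {vv x}    () _
  unmatched {eueuv f} () _
  unmatched {evuev f} () _

  matched-from-copy : ∀ c {x e b} → Matched e (copy c x) b → e ≡ vv x
  matched-from-copy true  (vv→ x) = refl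
  matched-from-copy false (vv← x) = refl

  matched-from-port : ∀ o {f e b} → Matched e (port o f) b → e ≡ stem o f × b ≡ inner o f
  matched-from-port true  (eueuv→ f) = refl , refl
  matched-from-port false (evuev← f) = refl , refl

  matched-from-inner : ∀ o {f e b} → Matched e (inner o f) b → e ≡ stem o f × b ≡ port o f
  matched-from-inner true  (eueuv← f) = refl , refl
  matched-from-inner false (evuev→ f) = refl , refl

  unmatched-from-copy : ∀ c {x e b} → Unmatched e (copy c x) b →
    Σ Bool λ o → Σ (Fin m) λ f → endpoint o f ≡ x × e ≡ link c o f × b ≡ port o f
  unmatched-from-copy true  (u₁eu→ f) = true  , f , refl , refl , refl
  unmatched-from-copy true  (evv₁← f) = false , f , refl , refl , refl
  unmatched-from-copy false (u₂eu→ f) = true  , f , refl , refl , refl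
  unmatched-from-copy false (evv₂← f) = false , f , refl , refl , refl

  unmatched-from-port : ∀ o {f e b} → Unmatched e (port o f) b →
    Σ Bool λ c → e ≡ link c o f × b ≡ copy c (endpoint o f)
  unmatched-from-port true  (u₁eu← f) = true  , refl , refl
  unmatched-from-port true  (u₂eu← f) = false , refl , refl
  unmatched-from-port false (evv₁→ f) = true  , refl , refl
  unmatched-from-port false (evv₂→ f) = false , refl , refl

  unmatched-from-inner : ∀ o {f e b} → Unmatched e (inner o f) b → e ≡ euvevu f × b ≡ inner (not o) f
  unmatched-from-inner true  (euvevu→ f) = refl , refl
  unmatched-from-inner false (euvevu← f) = refl , refl

  vv-ends : ∀ {x a b} → Joins H (vv x) a b → Σ Bool λ c → a ≡ copy c x × b ≡ copy (not c) x
  vv-ends (inj₁ refl) = true  , refl , refl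
  vv-ends (inj₂ refl) = false , refl , refl

  owner : V' n m → Fin n ⊎ Fin m
  owner (v₁ x)   = inj₁ x
  owner (v₂ x)   = inj₁ x
  owner (e-u f)  = inj₂ f
  owner (e-uv f) = inj₂ f
  owner (e-vu f) = inj₂ f
  owner (e-v f)  = inj₂ f

  owner-passVertex : ∀ x o f r → owner (passVertex x o f r) ≡ inj₁ x ⊎ owner (passVertex x o f r) ≡ inj₂ f
  owner-passVertex x o     f 0 = inj₁ refl
  owner-passVertex x o     f 1 = inj₁ refl
  owner-passVertex x true  f 2 = inj₂ refl
  owner-passVertex x false f 2 = inj₂ refl
  owner-passVertex x true  f 3 = inj₂ refl
  owner-passVertex x false f 3 = inj₂ refl
  owner-passVertex x true  f 4 = inj₂ refl
  owner-passVertex x false f 4 = inj₂ refl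
  owner-passVertex x true  f (suc (suc (suc (suc (suc r))))) = inj₂ refl
  owner-passVertex x false f (suc (suc (suc (suc (suc r))))) = inj₂ refl

  slot : Bool → V' n m → ℕ
  slot o     (v₁ _)   = 0
  slot o     (v₂ _)   = 1
  slot true  (e-u _)  = 2
  slot true  (e-uv _) = 3
  slot true  (e-vu _) = 4
  slot true  (e-v _)  = 5
  slot false (e-v _)  = 2
  slot false (e-vu _) = 3
  slot false (e-uv _) = 4
  slot false (e-u _)  = 5

  slot-passVertex : ∀ x o f r → r < 6 → slot o (passVertex x o f r) ≡ r
  slot-passVertex x o     f 0 _ = refl
  slot-passVertex x o     f 1 _ = refl
  slot-passVertex x true  f 2 _ = refl
  slot-passVertex x false f 2 _ = refl
  slot-passVertex x true  f 3 _ = refl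
  slot-passVertex x false f 3 _ = refl
  slot-passVertex x true  f 4 _ = refl
  slot-passVertex x false f 4 _ = refl
  slot-passVertex x true  f 5 _ = refl
  slot-passVertex x false f 5 _ = refl
  slot-passVertex x o f (suc (suc (suc (suc (suc (suc r)))))) (s≤s (s≤s (s≤s (s≤s (s≤s (s≤s ()))))))

  anchor : V' n m → Fin n
  anchor a = [ id , proj₁ ∘ ends ]′ (owner a)

  vv-injective : ∀ {x y} → vv {n} {m} x ≡ vv y → x ≡ y
  vv-injective refl = refl

  euvevu-injective : ∀ {f g} → euvevu {n} {m} f ≡ euvevu g → f ≡ g
  euvevu-injective refl = refl

  no-loop : Simple ends → ∀ {f a} → Joins G f a a → ⊥
  no-loop (loopless , _) {f} (inj₁ p) = loopless f (trans (cong proj₁ p) (sym (cong proj₂ p)))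
  no-loop (loopless , _) {f} (inj₂ p) = loopless f (trans (cong proj₁ p) (sym (cong proj₂ p)))

  no-parallel : Simple ends → ∀ {e f a b} → Joins G e a b → Joins G f b a → e ≡ f
  no-parallel (_ , unique) {e} {f} (inj₁ p) (inj₁ q) = unique e f (inj₂ (trans p (cong (λ (x , y) → y , x) (sym q))))
  no-parallel (_ , unique) {e} {f} (inj₁ p) (inj₂ q) = unique e f (inj₁ (trans p (sym q)))
  no-parallel (_ , unique) {e} {f} (inj₂ p) (inj₁ q) = unique e f (inj₁ (trans p (sym q)))
  no-parallel (_ , unique) {e} {f} (inj₂ p) (inj₂ q) = unique e f (inj₂ (trans p (cong (λ (x , y) → y , x) (sym q))))

module Expand {n m : ℕ} (ends : Fin m → Fin n × Fin n) (w : Fin m → ℤ) where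
  open Gadget ends w

  orient : Fin n → Fin m → Bool
  orient a f = does (proj₁ (ends f) Fin.≟ a)

  orient-endpoints : ∀ {f a b} → Joins G f a b → endpoint (orient a f) f ≡ a × endpoint (not (orient a f)) f ≡ b
  orient-endpoints {f} {a} J with proj₁ (ends f) Fin.≟ a | J
  ... | yes u≡a | inj₁ p = u≡a , cong proj₂ p
  ... | yes u≡a | inj₂ p = u≡a , trans (cong proj₂ p) (trans (sym u≡a) (cong proj₁ p))
  ... | no  u≢a | inj₁ p = ⊥-elim (u≢a (cong proj₁ p))
  ... | no  u≢a | inj₂ p = cong proj₂ p , cong proj₁ p

  module _ (c : Unrolled G) where
    private
      X = vertex c
      F = edge c

    orientation : ℕ → Bool
    orientation q = orient (X q) (F q)

    passVertices : ℕ → ℕ → V' n m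
    passVertices q = passVertex (X q) (orientation q) (F q)

    passEdges : ℕ → ℕ → E' n m
    passEdges q = passEdge (X q) false (orientation q) true (F q)

  expand-joins : ∀ c t → Joins H (blocks (passEdges c) t) (blocks (passVertices c) t) (blocks (passVertices c) (suc t))
  expand-joins c (suc (suc (suc (suc (suc (suc t)))))) = expand-joins (rotate c) t
  expand-joins c 0 = inj₁ refl
  expand-joins c 1 = subst (λ x → Joins H (link false o f) (v₂ x) (port o f)) (proj₁ (orient-endpoints (edge-joins c 0)))
                           (link-joins false o f)
    where o = orientation c 0; f = edge c 0
  expand-joins c 2 = stem-joins (orientation c 0) (edge c 0)
  expand-joins c 3 = bridge-joins (orientation c 0) (edge c 0)
  expand-joins c 4 = Joins-sym {H} (stem-joins (not (orientation c 0)) (edge c 0))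
  expand-joins c 5 = subst (λ y → Joins H (link true (not o) f) (port (not o) f) (v₁ y)) (proj₂ (orient-endpoints (edge-joins c 0)))
                           (Joins-sym {H} (link-joins true (not o) f))
    where o = orientation c 0; f = edge c 0

  module _ (c : Unrolled G) where
    private
      L = period c

    same-block : ∀ qa qb ra rb → qa < L → qb < L → owner (passVertices c qa ra) ≡ owner (passVertices c qb rb) → qa ≡ qb
    same-block qa qb ra rb qa<L qb<L eq
      with owner-passVertex (vertex c qa) (orientation c qa) (edge c qa) ra
         | owner-passVertex (vertex c qb) (orientation c qb) (edge c qb) rb
    ... | inj₁ p | inj₁ q = vertex-injective c qa qb qa<L qb<L (inj₁-injective (trans (sym p) (trans eq q)))
    ... | inj₂ p | inj₂ q = edge-injective c qa qb qa<L qb<L (inj₂-injective (trans (sym p) (trans eq q)))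
    ... | inj₁ p | inj₂ q with () ← trans (sym p) (trans eq q)
    ... | inj₂ p | inj₁ q with () ← trans (sym p) (trans eq q)

    expand-injective : ∀ a b → a < L * 6 → b < L * 6 → blocks (passVertices c) a ≡ blocks (passVertices c) b → a ≡ b
    expand-injective a b a< b< eq = begin
      a                  ≡⟨ m≡m%n+[m/n]*n a 6 ⟩
      a % 6 + a / 6 * 6  ≡⟨ cong₂ (λ r q → r + q * 6) ra≡rb qa≡qb ⟩
      b % 6 + b / 6 * 6  ≡⟨ sym (m≡m%n+[m/n]*n b 6) ⟩
      b                  ∎
      where
      open ≡-Reasoning
      qa = a / 6
      qb = b / 6
      same-vertex : passVertices c qa (a % 6) ≡ passVertices c qb (b % 6)
      same-vertex = trans (sym (blocks-decompose (passVertices c) a)) (trans eq (blocks-decompose (passVertices c) b))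
      qa≡qb : qa ≡ qb
      qa≡qb = same-block qa qb (a % 6) (b % 6) (m<n*o⇒m/o<n a<) (m<n*o⇒m/o<n b<) (cong owner same-vertex)
      ra≡rb : a % 6 ≡ b % 6
      ra≡rb = begin
        a % 6                               ≡⟨ sym (slot-passVertex _ o _ (a % 6) (m%n<n a 6)) ⟩
        slot o (passVertices c qa (a % 6))  ≡⟨ cong (slot o) (trans same-vertex (cong (λ q → passVertices c q (b % 6)) (sym qa≡qb))) ⟩
        slot o (passVertices c qa (b % 6))  ≡⟨ slot-passVertex _ o _ (b % 6) (m%n<n b 6) ⟩
        b % 6                               ∎
        where o = orientation c qa

    passVertex-anchored : ∀ q r → Σ ℕ λ s → anchor (passVertices c q r) ≡ vertex c s
    passVertex-anchored q r with owner-passVertex (vertex c q) (orientation c q) (edge c q) r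
    ... | inj₁ p = q , cong [ id , proj₁ ∘ ends ]′ p
    ... | inj₂ p with edge-joins c q
    ...   | inj₁ J = q     , trans (cong [ id , proj₁ ∘ ends ]′ p) (cong proj₁ J)
    ...   | inj₂ J = suc q , trans (cong [ id , proj₁ ∘ ends ]′ p) (cong proj₁ J)

    expand-anchored : ∀ t → Σ ℕ λ s → anchor (blocks (passVertices c) t) ≡ vertex c s
    expand-anchored t =
      let s , p = passVertex-anchored (t / 6) (t % 6) in s , trans (cong anchor (blocks-decompose (passVertices c) t)) p

    expand : Unrolled H
    expand = record
      { size             = 15 + size c * 6
      ; vertex           = blocks (passVertices c)
      ; edge             = blocks (passEdges c)
      ; vertex-periodic  = λ t → trans (blocks-shift (passVertices c) L t) (blocks-cong (λ q r →
                                   cong₂ (λ x f → passVertex x (orient x f) f r) (vertex-periodic c q) (edge-periodic c q)) t)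
      ; edge-periodic    = λ t → trans (blocks-shift (passEdges c) L t) (blocks-cong (λ q r →
                                   cong₂ (λ x f → passEdge x false (orient x f) true f r) (vertex-periodic c q) (edge-periodic c q)) t)
      ; edge-joins       = expand-joins c
      ; vertex-injective = expand-injective
      }

    expand-weight : weight expand ≡ weight c
    expand-weight = trans (blocks-sum (w' ends w) (passEdges c) L)
      (sumℕ-cong L (λ q _ → passEdge-weight (vertex c q) false (orientation c q) true (edge c q)))

    expand-even : Even (period expand)
    expand-even = Even-*6 L

  expand-alternates : ∀ c → Alternates (M ends w) (expand c)
  expand-alternates c (suc (suc (suc (suc (suc (suc t)))))) = expand-alternates (rotate c) t
  expand-alternates c 0 = passEdge-alternates (vertex c 0) false (orientation c 0) true (edge c 0) 0 (ℕ.<ᵇ⇒< 0 5 _)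
  expand-alternates c 1 = passEdge-alternates (vertex c 0) false (orientation c 0) true (edge c 0) 1 (ℕ.<ᵇ⇒< 1 5 _)
  expand-alternates c 2 = passEdge-alternates (vertex c 0) false (orientation c 0) true (edge c 0) 2 (ℕ.<ᵇ⇒< 2 5 _)
  expand-alternates c 3 = passEdge-alternates (vertex c 0) false (orientation c 0) true (edge c 0) 3 (ℕ.<ᵇ⇒< 3 5 _)
  expand-alternates c 4 = passEdge-alternates (vertex c 0) false (orientation c 0) true (edge c 0) 4 (ℕ.<ᵇ⇒< 4 5 _)
  expand-alternates c 5 = passEdge-exit (vertex c 0) false (orientation c 0) true (edge c 0) (vertex c 1)

module Contract {n m : ℕ} (ends : Fin m → Fin n × Fin n) (w : Fin m → ℤ) where
  open Gadget ends w

  private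
    M′ = M ends w
    w″ = w' ends w

  record Contraction (c : Unrolled H) : Set where
    field
      cycle      : Unrolled G
      weight-≡   : weight cycle ≡ weight c
      v₁-visited : ∀ k → ∃[ t ] vertex c t ≡ v₁ (vertex cycle k)

  module Walk (c : Unrolled H) (alt : Alternates M′ c) where

    flip : ∀ {t b} → M′ (edge c t) ≡ b → M′ (edge c (suc t)) ≡ not b
    flip {t} p = trans (alt t) (cong not p)

    matched-at : ∀ {t a} → M′ (edge c t) ≡ true → vertex c t ≡ a → Matched (edge c t) a (vertex c (suc t))
    matched-at {t} m refl = matched m (edge-joins c t)

    unmatched-at : ∀ {t a} → M′ (edge c t) ≡ false → vertex c t ≡ a → Unmatched (edge c t) a (vertex c (suc t))
    unmatched-at {t} m refl = unmatched m (edge-joins c t)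

    CopyEdgeAt : ℕ → Set
    CopyEdgeAt t = ∃[ x ] edge c t ≡ vv x

    start-from-copy : ∀ {t} b x → M′ (edge c t) ≡ true → vertex c t ≡ copy b x → ∃[ s ] CopyEdgeAt s
    start-from-copy {t} b x m v = t , x , matched-from-copy b (matched-at m v)

    start-from-inner : ∀ {t} o f → M′ (edge c t) ≡ true → vertex c t ≡ inner o f → ∃[ s ] CopyEdgeAt s
    start-from-inner o f m v =
      let _ , v₁≡ = matched-from-inner o (matched-at m v)
          b , _ , v₂≡ = unmatched-from-port o (unmatched-at (flip m) v₁≡)
      in start-from-copy b (endpoint o f) (flip (flip m)) v₂≡

    start-from-port : ∀ {t} o f → M′ (edge c t) ≡ true → vertex c t ≡ port o f → ∃[ s ] CopyEdgeAt s
    start-from-port o f m v =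
      let _ , v₁≡ = matched-from-port o (matched-at m v)
          _ , v₂≡ = unmatched-from-inner o (unmatched-at (flip m) v₁≡)
      in start-from-inner (not o) f (flip (flip m)) v₂≡

    start-from : ∀ t → M′ (edge c t) ≡ true → ∃[ s ] CopyEdgeAt s
    start-from t m with vertex c t in v
    ... | v₁ x   = start-from-copy true x m v
    ... | v₂ x   = start-from-copy false x m v
    ... | e-u f  = start-from-port true f m v
    ... | e-v f  = start-from-port false f m v
    ... | e-uv f = start-from-inner true f m v
    ... | e-vu f = start-from-inner false f m v

    find-start : ∃[ s ] CopyEdgeAt s
    find-start with M′ (edge c 0) in m₀
    ... | true  = start-from 0 m₀
    ... | false = start-from 1 (flip m₀)

    record Pass (s : ℕ) (x : Fin n) : Set where
      field
        entry exit orientation : Bool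
        via     : Fin m
        enters  : endpoint orientation via ≡ x
        follows : ∀ r → r < 6 → edge c (r + s) ≡ passEdge x entry orientation exit via r
        exits   : edge c (6 + s) ≡ vv (endpoint (not orientation) via)

      next : Fin n
      next = endpoint (not orientation) via

      pass-joins : Joins G via x next
      pass-joins = subst (λ y → Joins G via y next) enters (endpoint-joins orientation via)

      pass-weight : sumℕ (λ r → w″ (edge c (r + s))) 6 ≡ w via
      pass-weight = trans (sumℕ-cong 6 (λ r r<6 → cong w″ (follows r r<6))) (passEdge-weight x entry orientation exit via)

    pass : ∀ s x → edge c s ≡ vv x → Pass s x
    pass s x e₀ =
      let m₀ = cong M′ e₀; m₁ = flip m₀; m₂ = flip m₁; m₃ = flip m₂; m₄ = flip m₃; m₅ = flip m₄; m₆ = flip m₅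
          b , _ , v₁≡ = vv-ends (subst (λ e → Joins H e (vertex c s) (vertex c (1 + s))) e₀ (edge-joins c s))
          o , f , enters , e₁ , v₂≡ = unmatched-from-copy (not b) (unmatched-at m₁ v₁≡)
          e₂ , v₃≡ = matched-from-port o (matched-at m₂ v₂≡)
          e₃ , v₄≡ = unmatched-from-inner o (unmatched-at m₃ v₃≡)
          e₄ , v₅≡ = matched-from-inner (not o) (matched-at m₄ v₄≡)
          b′ , e₅ , v₆≡ = unmatched-from-port (not o) (unmatched-at m₅ v₅≡)
          e₆ = matched-from-copy b′ (matched-at m₆ v₆≡)
      in record
        { entry = not b ; exit = b′ ; orientation = o ; via = f ; enters = enters ; exits = e₆
        ; follows = λ where
            0 _ → e₀
            1 _ → e₁
            2 _ → e₂
            3 _ → e₃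
            4 _ → e₄
            5 _ → e₅
            (suc (suc (suc (suc (suc (suc _)))))) (s≤s (s≤s (s≤s (s≤s (s≤s (s≤s ()))))))
        }

    module FromStart (x₀ : Fin n) (start : edge c 0 ≡ vv x₀) where
      private
        L′ = period c

      starts : ∀ k → CopyEdgeAt (k * 6)
      starts zero    = x₀ , start
      starts (suc k) = let P = pass (k * 6) (proj₁ (starts k)) (proj₂ (starts k)) in Pass.next P , Pass.exits P

      X : ℕ → Fin n
      X k = proj₁ (starts k)

      P : ∀ k → Pass (k * 6) (X k)
      P k = pass (k * 6) (X k) (proj₂ (starts k))

      F : ℕ → Fin m
      F k = Pass.via (P k)

      F-middle : ∀ k → edge c (3 + k * 6) ≡ euvevu (F k)
      F-middle k = Pass.follows (P k) 3 (ℕ.<ᵇ⇒< 3 6 _)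

      blocks-aligned : L′ ≡ (L′ / 6) * 6
      blocks-aligned = trans (m≡m%n+[m/n]*n L′ 6) (cong (_+ L′ / 6 * 6) (aligned (L′ % 6) (m%n<n L′ 6) (sym (m≡m%n+[m/n]*n L′ 6))))
        where
        -- The edge at position L′ is the copy edge at 0, and no copy edge lies strictly inside a pass.
        aligned : ∀ r → r < 6 → r + (L′ / 6) * 6 ≡ L′ → r ≡ 0
        aligned zero    _   _  = refl
        aligned (suc r) r<6 eq = ⊥-elim (passEdge-not-vv _ _ _ _ _ r x₀
          (trans (sym (Pass.follows (P (L′ / 6)) (suc r) r<6)) (trans (cong (edge c) eq) (trans (edge-period c) start))))

      module _ (q : ℕ) (q*6≡L′ : q * 6 ≡ L′) where

        edge-wraps : ∀ k t → edge c (t + (q + k) * 6) ≡ edge c (t + k * 6)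
        edge-wraps k t = begin
          edge c (t + (q + k) * 6)        ≡⟨ cong (λ i → edge c (t + i)) (ℕ.*-distribʳ-+ 6 q k) ⟩
          edge c (t + (q * 6 + k * 6))    ≡⟨ cong (edge c) (x∙yz≈y∙xz t (q * 6) (k * 6)) ⟩
          edge c (q * 6 + (t + k * 6))    ≡⟨ cong (λ i → edge c (i + (t + k * 6))) q*6≡L′ ⟩
          edge c (L′ + (t + k * 6))       ≡⟨ edge-periodic c (t + k * 6) ⟩
          edge c (t + k * 6)              ∎
          where open ≡-Reasoning

        X-wraps : ∀ k → X (q + k) ≡ X k
        X-wraps k = vv-injective (trans (sym (proj₂ (starts (q + k)))) (trans (edge-wraps k 0) (proj₂ (starts k))))

        F-wraps : ∀ k → F (q + k) ≡ F k
        F-wraps k = euvevu-injective (trans (sym (F-middle (q + k))) (trans (edge-wraps k 3) (F-middle k)))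

        X-injective : ∀ a b → a < q → b < q → X a ≡ X b → a ≡ b
        X-injective a b a<q b<q Xa≡Xb = ℕ.*-cancelʳ-≡ a b 6 (edge-injective c (a * 6) (b * 6) (below a<q) (below b<q)
          (trans (proj₂ (starts a)) (trans (cong vv Xa≡Xb) (sym (proj₂ (starts b))))))
          where
          below : ∀ {i} → i < q → i * 6 < L′
          below {i} i<q = subst (i * 6 <_) q*6≡L′ (ℕ.*-monoˡ-< 6 i<q)

        weight-blocks : weight c ≡ sumℕ (λ k → w (F k)) q
        weight-blocks = begin
          sumℕ (λ t → w″ (edge c t)) L′                                   ≡⟨ cong (sumℕ (λ t → w″ (edge c t))) (sym q*6≡L′) ⟩
          sumℕ (λ t → w″ (edge c t)) (q * 6)                              ≡⟨ sumℕ-chunks (λ t → w″ (edge c t)) 6 q ⟩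
          sumℕ (λ k → sumℕ (λ r → w″ (edge c (r + k * 6))) 6) q          ≡⟨ sumℕ-cong q (λ k _ → Pass.pass-weight (P k)) ⟩
          sumℕ (λ k → w (F k)) q                                          ∎
          where open ≡-Reasoning

      no-two-passes : Simple ends → 2 * 6 ≢ L′
      no-two-passes simple eq = 3≢9 (edge-injective c 3 9 (below 3 (ℕ.<ᵇ⇒< 3 12 _)) (below 9 (ℕ.<ᵇ⇒< 9 12 _))
        (trans (F-middle 0) (trans (cong euvevu F₀≡F₁) (sym (F-middle 1)))))
        where
        below : ∀ i → i < 12 → i < L′
        below i i<12 = subst (i <_) eq i<12
        3≢9 : 3 ≢ 9
        3≢9 ()
        F₀≡F₁ : F 0 ≡ F 1
        F₀≡F₁ = no-parallel simple (Pass.pass-joins (P 0)) (subst (Joins G (F 1) (X 1)) (X-wraps 2 eq 0) (Pass.pass-joins (P 1)))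

      at-least-three-passes : Simple ends → ∀ q → q * 6 ≡ L′ → ∃[ l ] (3 + l) * 6 ≡ L′
      at-least-three-passes simple (suc (suc (suc l))) eq = l , eq
      at-least-three-passes simple 1 eq =
        ⊥-elim (no-loop simple (subst (Joins G (F 0) x₀) (X-wraps 1 eq 0) (Pass.pass-joins (P 0))))
      at-least-three-passes simple 2 eq = ⊥-elim (no-two-passes simple eq)

      v₁-visited : ∀ k → ∃[ t ] vertex c t ≡ v₁ (X k)
      v₁-visited k with vv-ends (subst (λ e → Joins H e (vertex c (k * 6)) (vertex c (suc (k * 6)))) (proj₂ (starts k)) (edge-joins c (k * 6)))
      ... | true  , v≡ , _ = k * 6 , v≡
      ... | false , _ , v≡ = suc (k * 6) , v≡

      contraction : Simple ends → Contraction c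
      contraction simple =
        let l , eq = at-least-three-passes simple (L′ / 6) (sym blocks-aligned)
        in record
          { cycle = record
            { size             = l
            ; vertex           = X
            ; edge             = F
            ; vertex-periodic  = X-wraps (3 + l) eq
            ; edge-periodic    = F-wraps (3 + l) eq
            ; edge-joins       = λ k → Pass.pass-joins (P k)
            ; vertex-injective = X-injective (3 + l) eq
            }
          ; weight-≡   = sym (weight-blocks (3 + l) eq)
          ; v₁-visited = v₁-visited
          }

  opaque
    contract : Simple ends → (c : Unrolled H) → Alternates M′ c → Contraction c
    contract simple c alt =
      let s , x , start = Walk.find-start c alt
          c₀ = rotateBy s c
          start₀ = trans (rotateBy-edge s c 0) (trans (cong (edge c) (ℕ.+-identityʳ s)) start)
          C = Walk.FromStart.contraction c₀ (rotateBy-alternates M′ s c alt) x start₀ simple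
      in record
        { cycle      = Contraction.cycle C
        ; weight-≡   = trans (Contraction.weight-≡ C) (rotateBy-weight s c)
        ; v₁-visited = λ k → let t , v≡ = Contraction.v₁-visited C k in s + t , trans (sym (rotateBy-vertex s c t)) v≡
        }

module Correspondence {n m : ℕ} (ends : Fin m → Fin n × Fin n) (w : Fin m → ℤ) where
  open Gadget ends w
  open Expand ends w
  open Contract ends w

  DisjointCycles : ℕ → ℤ → Set
  DisjointCycles p k = Σ (Fin p → Cycle G) λ C → VertexDisjoint C × totalWeight C ≡ k

  DisjointAlternatingCycles : ℕ → ℤ → Set
  DisjointAlternatingCycles p k =
    Σ (Fin p → Cycle H) λ C → ((i : Fin p) → Alternating H (M ends w) (C i)) × VertexDisjoint C × totalWeight C ≡ k

  expand-all : ∀ {p k} → DisjointCycles p k → DisjointAlternatingCycles p k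
  expand-all {p} {k} (C , disjoint , total) = roll ∘ U , alternating , disjoint′ , total′
    where
    U : Fin p → Unrolled H
    U i = expand (unroll (C i))
    alternating : (i : Fin p) → Alternating H (M ends w) (roll (U i))
    alternating i = expand-even (unroll (C i)) , roll-alternates (U i) (M ends w) (expand-alternates (unroll (C i)))
    disjoint′ : VertexDisjoint (roll ∘ U)
    disjoint′ = VertexDisjoint-comap C (roll ∘ U) anchor
      (λ i a → let s , a↦s = expand-anchored (unroll (C i)) (toℕ a) in s mod _ , a↦s) disjoint
    total′ : totalWeight (roll ∘ U) ≡ k
    total′ = trans (∑-cong λ i → trans (roll-weight (U i)) (trans (expand-weight (unroll (C i))) (unroll-weight (C i)))) total

  contract-all : Simple ends → ∀ {p k} → DisjointAlternatingCycles p k → DisjointCycles p k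
  contract-all simple {p} {k} (C′ , alternating , disjoint′ , total′) = roll ∘ U , disjoint , total
    where
    K : (i : Fin p) → Contraction (unroll (C′ i))
    K i = contract simple (unroll (C′ i)) (unroll-alternates (C′ i) (M ends w) (proj₂ (alternating i)))
    U : Fin p → Unrolled G
    U i = Contraction.cycle (K i)
    disjoint : VertexDisjoint (roll ∘ U)
    disjoint = VertexDisjoint-comap C′ (roll ∘ U) v₁
      (λ i a → let t , t↦a = Contraction.v₁-visited (K i) (toℕ a) in t mod _ , sym t↦a) disjoint′
    total : totalWeight (roll ∘ U) ≡ k
    total = trans (∑-cong λ i → trans (roll-weight (U i)) (trans (Contraction.weight-≡ (K i)) (unroll-weight (C′ i)))) total′

mainTheorem7 : (n m : ℕ) (ends : Fin m → Fin n × Fin n) (w : Fin m → ℤ) →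
    Simple ends → Conservative (mkG n m ends w) →
    (k : ℤ) (p : ℕ) → 1 ≤ p →
    (Σ (Fin p → Cycle (mkG n m ends w)) λ C → VertexDisjoint C × totalWeight C ≡ k)
    ⇔
    (Σ (Fin p → Cycle (G' ends w)) λ C →
       ((i : Fin p) → Alternating (G' ends w) (M ends w) (C i)) × VertexDisjoint C × totalWeight C ≡ k)
mainTheorem7 n m ends w simple _ k p _ = mk⇔ expand-all (contract-all simple)
  where open Correspondence ends w
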